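{- Let $G$ be a connected graph of order $n$ with girth $g(G)\geq 7$, and let $n_L$ be the number of end-vertices of $G$. Then (1) $\gamma_{\rm wcon}(G)=n-n_L$; (2) $\gamma_{\rm wcon}(G)=\gamma_c(G)$ if and only if every vertex of $G$ is either an end-vertex or a cut-vertex.
   Context: Graphs are finite, simple, undirected, connected. $g(G)$ is the length of a shortest cycle (infinite for acyclic graphs). An end-vertex is a vertex of degree 1; a cut-vertex is a vertex whose removal increases the number of components. A set $D$ is dominating if every vertex outside $D$ has a neighbour in $D$; connected dominating if also $G[D]$ is connected; weakly convex if for any $a,b\in D$ some shortest $(a-b)$-path in $G$ lies in $D$. $\gamma_c(G)$, $\gamma_{\rm wcon}(G)$ denote the minimum sizes of a connected dominating set and a weakly convex dominating set. -}

module Defs where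

open import Data.Nat using (ℕ; zero; suc; _≤_; _∸_)
open import Data.Bool using (Bool; true; false)
open import Data.Fin using (Fin)
open import Data.Fin.Subset using (Subset; _∈_; ∣_∣)
open import Data.Vec using (tabulate)
open import Data.List using (List; []; _∷_)
open import Data.List.Relation.Unary.Unique.Propositional using (Unique)
open import Data.Sum using (_⊎_)
open import Data.Product using (Σ; _×_; ∃; ∃-syntax)
open import Relation.Binary.PropositionalEquality using (_≡_; _≢_)
open import Relation.Nullary using (¬_)

record Graph (n : ℕ) : Set where
  field
    adj    : Fin n → Fin n → Bool
    sym    : ∀ u v → adj u v ≡ adj v u
    irrefl : ∀ v → adj v v ≡ false
open Graph public

module _ {n : ℕ} (G : Graph n) where

  data WalkIn (P : Fin n → Set) : Fin n → Fin n → ℕ → Set where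
    [_] : ∀ {a} → P a → WalkIn P a a 0
    step : ∀ {a b c k} → adj G a b ≡ true → P a → WalkIn P b c k → WalkIn P a c (suc k)

  verts : ∀ {P a c k} → WalkIn P a c k → List (Fin n)
  verts ([_] {a} _) = a ∷ []
  verts (step {a} _ _ w) = a ∷ verts w

  Walk : Fin n → Fin n → ℕ → Set
  Walk a b k = WalkIn (λ _ → Fin n) a b k

  Connected : Set
  Connected = ∀ a b → ∃[ k ] Walk a b k

  -- A cycle of length suc k (≥ 3): a walk a → b of length k ≥ 2 with
  -- pairwise distinct vertices, closed up by the edge b a.
  -- g(G) ≥ 7 : every cycle has length ≥ 7.
  GirthAtLeast7 : Set
  GirthAtLeast7 = ∀ a b k (w : Walk a b k) → 2 ≤ k → Unique (verts w) →
                  adj G b a ≡ true → 7 ≤ suc k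

  degree : Fin n → ℕ
  degree v = ∣ tabulate (adj G v) ∣

  EndVertex : Fin n → Set
  EndVertex v = degree v ≡ 1

  isEnd : Fin n → Bool
  isEnd v with degree v
  ... | 1 = true
  ... | _ = false

  nL : ℕ
  nL = ∣ tabulate isEnd ∣

  -- Cut-vertex (for a connected graph): G - v is disconnected, i.e. some two
  -- vertices other than v are joined by no walk avoiding v.
  CutVertex : Fin n → Set
  CutVertex v = ∃[ a ] ∃[ b ] (a ≢ v × b ≢ v × (∀ k → ¬ WalkIn (λ x → x ≢ v) a b k))

  Dominating : Subset n → Set
  Dominating D = ∀ v → v ∈ D ⊎ (∃[ u ] (u ∈ D × adj G v u ≡ true))

  ConnectedDominating : Subset n → Set
  ConnectedDominating D = Dominating D ×
    (∀ a b → a ∈ D → b ∈ D → ∃[ k ] WalkIn (λ x → x ∈ D) a b k)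

  WeaklyConvex : Subset n → Set
  WeaklyConvex D = ∀ a b → a ∈ D → b ∈ D →
    ∃[ k ] (WalkIn (λ x → x ∈ D) a b k × (∀ m → Walk a b m → k ≤ m))

  WeaklyConvexDominating : Subset n → Set
  WeaklyConvexDominating D = Dominating D × WeaklyConvex D

  MinSize : (Subset n → Set) → ℕ → Set
  MinSize P k = (∃[ D ] (P D × ∣ D ∣ ≡ k)) × (∀ D → P D → k ≤ ∣ D ∣)

  γwcon≡ : ℕ → Set
  γwcon≡ = MinSize WeaklyConvexDominating

  γc≡ : ℕ → Set
  γc≡ = MinSize ConnectedDominating

-- The non-end vertices form a weakly convex dominating set: the interior vertices of a shortest
-- path have two neighbours on it, and since n ≥ 3 the neighbour of an end-vertex is not an
-- end-vertex. Conversely, a weakly convex dominating set D contains every non-end vertex v: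
-- otherwise v has a neighbour u ∈ D and a second neighbour w, and a shortest path inside D from
-- w (or from a neighbour of w in D) to u closes a cycle through v of length at most 6.
-- For (2): a cut-vertex lies in every connected dominating set, while if v is neither an
-- end-vertex nor a cut-vertex, the non-end vertices other than v still form a connected
-- dominating set.

module Submission where

open import Defs
open import Data.Nat using (ℕ; zero; suc; _+_; _≤_; _<_; _∸_; z≤n; s≤s; _≤?_)
open import Data.Nat.Properties
  using (≤-refl; ≤-trans; 1+n≰n; ≤-antisym; ≤-pred; m≤n⇒m≤1+n; ≮⇒≥; <⇒≱; anyUpTo?) renaming (_≟_ to _≟ℕ_)
open import Data.Nat.Induction using (<-wellFounded)
open import Induction.WellFounded using (Acc; acc)
open import Data.Bool using (Bool; true) renaming (_≟_ to _≟ᵇ_)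
open import Data.Fin using (Fin; zero; suc)
open import Data.Fin.Properties using (_≟_; any?)
open import Data.Fin.Subset using (Subset; _∈_; _∉_; _⊆_; ∣_∣; ∁; _─_; _-_; ⊤; ⁅_⁆; inside; outside)
open import Data.Fin.Subset.Properties
  using ( _∈?_; ∈⊤; ∣⊤∣≡n; ∣⁅x⁆∣≡1; x∈⁅x⁆; x∈⁅y⁆⇒x≡y; p⊆q⇒∣p∣≤∣q∣; ∣∁p∣≡n∸∣p∣
        ; x∈∁p⇒x∉p; x∉p⇒x∈∁p; p─q⊆p; x∈p∧x≢y⇒x∈p-y; x∈p⇒∣p-x∣<∣p∣)
open import Data.Vec using (_∷_; here; there; tabulate)
open import Data.Vec.Properties using (lookup∘tabulate; []=⇒lookup; lookup⇒[]=)
open import Data.List using (List; []; _∷_; length)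
open import Data.List.Relation.Unary.All as All using (All; []; _∷_)
open import Data.List.Relation.Unary.All.Properties using (¬Any⇒All¬)
open import Data.List.Relation.Unary.Any using (Any; here; there)
open import Data.List.Relation.Unary.AllPairs using ([]; _∷_)
open import Data.List.Relation.Unary.Unique.Propositional using (Unique)
open import Data.Empty using (⊥; ⊥-elim)
open import Data.Product using (_×_; _,_; proj₂; ∃-syntax; uncurry)
open import Data.Sum using (_⊎_; inj₁; inj₂; [_,_]′)
open import Function using (_∘_)
open import Function.Bundles using (_⇔_; mk⇔; Equivalence)
open import Relation.Binary.PropositionalEquality as ≡
  using (_≡_; _≢_; refl; trans; cong; subst; ≢-sym)
open import Relation.Nullary using (¬_; Dec; yes; no; contradiction)
open import Relation.Nullary.Decidable using (_×-dec_; ¬?; from-no; map′)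
import Relation.Unary as U

private variable
  m : ℕ
  p q : Subset m
  x y : Fin m

∈-tabulate⁺ : {f : Fin m → Bool} → f x ≡ true → x ∈ tabulate f
∈-tabulate⁺ {x = x} {f = f} fx = lookup⇒[]= x (tabulate f) (trans (lookup∘tabulate f x) fx)

∈-tabulate⁻ : {f : Fin m → Bool} → x ∈ tabulate f → f x ≡ true
∈-tabulate⁻ {x = x} {f = f} x∈ = trans (≡.sym (lookup∘tabulate f x)) ([]=⇒lookup x∈)

x∈p─q⇒x∉q : x ∈ p ─ q → x ∉ q
x∈p─q⇒x∉q {p = _ ∷ _} {outside ∷ _} (there x∈) (there x∈q) = x∈p─q⇒x∉q x∈ x∈q
x∈p─q⇒x∉q {p = _ ∷ _} {inside ∷ _}  (there x∈) (there x∈q) = x∈p─q⇒x∉q x∈ x∈q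

x∈p-y⇒x≢y : x ∈ p - y → x ≢ y
x∈p-y⇒x≢y x∈ refl = x∈p─q⇒x∉q x∈ (x∈⁅x⁆ _)

x∈p∧y∉p⇒x≢y : x ∈ p → y ∉ p → x ≢ y
x∈p∧y∉p⇒x≢y x∈p y∉p refl = y∉p x∈p

x∈p⇒1≤∣p∣ : x ∈ p → 1 ≤ ∣ p ∣
x∈p⇒1≤∣p∣ {x = x} {p = p} x∈p = subst (_≤ ∣ p ∣) (∣⁅x⁆∣≡1 x)
  (p⊆q⇒∣p∣≤∣q∣ λ y∈ → subst (_∈ p) (≡.sym (x∈⁅y⁆⇒x≡y x y∈)) x∈p)

x,y∈p∧x≢y⇒2≤∣p∣ : x ∈ p → y ∈ p → x ≢ y → 2 ≤ ∣ p ∣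
x,y∈p∧x≢y⇒2≤∣p∣ x∈p y∈p x≢y = ≤-trans (s≤s (x∈p⇒1≤∣p∣ (x∈p∧x≢y⇒x∈p-y x∈p x≢y))) (x∈p⇒∣p-x∣<∣p∣ y∈p)

p⊆⁅x⁆⇒∣p∣≤1 : p ⊆ ⁅ x ⁆ → ∣ p ∣ ≤ 1
p⊆⁅x⁆⇒∣p∣≤1 {p = p} {x = x} p⊆ = subst (∣ p ∣ ≤_) (∣⁅x⁆∣≡1 x) (p⊆q⇒∣p∣≤∣q∣ p⊆)

unique⇒length≤∣p∣ : {xs : List (Fin m)} → Unique xs → All (_∈ p) xs → length xs ≤ ∣ p ∣
unique⇒length≤∣p∣ [] [] = z≤n
unique⇒length≤∣p∣ (x∉xs ∷ xs-unique) (x∈p ∷ xs⊆p) = ≤-trans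
  (s≤s (unique⇒length≤∣p∣ xs-unique (All.zipWith (λ (x≢y , y∈p) → x∈p∧x≢y⇒x∈p-y y∈p (≢-sym x≢y)) (x∉xs , xs⊆p))))
  (x∈p⇒∣p-x∣<∣p∣ x∈p)

unique⇒length≤n : {xs : List (Fin m)} → Unique xs → length xs ≤ m
unique⇒length≤n {m} {xs} xs-unique =
  subst (length xs ≤_) (∣⊤∣≡n m) (unique⇒length≤∣p∣ xs-unique (All.universal (λ _ → ∈⊤) xs))

≢? : (y : Fin m) → U.Decidable (_≢ y)
≢? y x = ¬? (x ≟ y)

another-vertex : 3 ≤ m → (x y : Fin m) → ∃[ z ] (z ≢ x × z ≢ y)
another-vertex (s≤s (s≤s (s≤s _))) zero          zero          = suc zero , (λ ()) , (λ ())
another-vertex (s≤s (s≤s (s≤s _))) zero          (suc zero)    = suc (suc zero) , (λ ()) , (λ ())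
another-vertex (s≤s (s≤s (s≤s _))) zero          (suc (suc _)) = suc zero , (λ ()) , (λ ())
another-vertex (s≤s (s≤s (s≤s _))) (suc zero)    zero          = suc (suc zero) , (λ ()) , (λ ())
another-vertex (s≤s (s≤s (s≤s _))) (suc zero)    (suc _)       = zero , (λ ()) , (λ ())
another-vertex (s≤s (s≤s (s≤s _))) (suc (suc _)) zero          = suc zero , (λ ()) , (λ ())
another-vertex (s≤s (s≤s (s≤s _))) (suc (suc _)) (suc _)       = zero , (λ ()) , (λ ())

module _ {P : ℕ → Set} (P? : U.Decidable P) where

  least : ∀ {k} → P k → ∃[ l ] (P l × (∀ j → P j → l ≤ j))
  least {k} = search k (<-wellFounded k)
    where
    search : ∀ k → Acc _<_ k → P k → ∃[ l ] (P l × (∀ j → P j → l ≤ j))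
    search k (acc smaller) pk with anyUpTo? P? k
    ... | yes (l , l<k , pl) = search l (smaller l<k) pl
    ... | no none = k , pk , λ j pj → ≮⇒≥ λ j<k → none (j , j<k , pj)

MinSize-unique : {G : Graph m} {P : Subset m → Set} {k l : ℕ} → MinSize G P k → MinSize G P l → k ≡ l
MinSize-unique ((D , PD , ∣D∣≡k) , k-min) ((E , PE , ∣E∣≡l) , l-min) =
  ≤-antisym (subst (_ ≤_) ∣E∣≡l (k-min E PE)) (subst (_ ≤_) ∣D∣≡k (l-min D PD))

module _ {n : ℕ} (G : Graph n) where

  private variable
    P Q : Fin n → Set
    D : Subset n
    a b c u v w z : Fin n
    k : ℕ

  adj-sym : adj G a b ≡ true → adj G b a ≡ true
  adj-sym {a} {b} ab = trans (sym G b a) ab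

  adj⇒≢ : adj G a b ≡ true → a ≢ b
  adj⇒≢ {a} aa refl = contradiction (trans (≡.sym aa) (irrefl G a)) λ ()

  two-neighbours⇒¬End : adj G v a ≡ true → adj G v b ≡ true → a ≢ b → ¬ EndVertex G v
  two-neighbours⇒¬End va vb a≢b end =
    from-no (2 ≤? 1) (subst (2 ≤_) end (x,y∈p∧x≢y⇒2≤∣p∣ (∈-tabulate⁺ va) (∈-tabulate⁺ vb) a≢b))

  End⇒neighbour-unique : EndVertex G v → adj G v a ≡ true → adj G v b ≡ true → a ≡ b
  End⇒neighbour-unique {a = a} {b} end va vb with a ≟ b
  ... | yes a≡b = a≡b
  ... | no a≢b = contradiction end (two-neighbours⇒¬End va vb a≢b)

  ¬End⇒another-neighbour : ¬ EndVertex G v → adj G v a ≡ true → ∃[ b ] (b ≢ a × adj G v b ≡ true)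
  ¬End⇒another-neighbour {v} {a} ¬end va with any? (λ b → ¬? (b ≟ a) ×-dec (adj G v b ≟ᵇ true))
  ... | yes found = found
  ... | no none = contradiction (≤-antisym (p⊆⁅x⁆⇒∣p∣≤1 only-a) (x∈p⇒1≤∣p∣ (∈-tabulate⁺ {f = adj G v} va))) ¬end
    where
    only-a : tabulate (adj G v) ⊆ ⁅ a ⁆
    only-a {b} b∈ with b ≟ a
    ... | yes refl = x∈⁅x⁆ a
    ... | no b≢a = contradiction (b , b≢a , ∈-tabulate⁻ b∈) none

  isEnd⇔EndVertex : isEnd G v ≡ true ⇔ EndVertex G v
  isEnd⇔EndVertex {v} with degree G v
  ... | zero = mk⇔ (λ ()) (λ ())
  ... | suc zero = mk⇔ (λ _ → refl) (λ _ → refl)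
  ... | suc (suc _) = mk⇔ (λ ()) (λ ())

  NonEnds : Subset n
  NonEnds = ∁ (tabulate (isEnd G))

  ∣NonEnds∣ : ∣ NonEnds ∣ ≡ n ∸ nL G
  ∣NonEnds∣ = ∣∁p∣≡n∸∣p∣ (tabulate (isEnd G))

  ∈NonEnds⁺ : ¬ EndVertex G v → v ∈ NonEnds
  ∈NonEnds⁺ ¬end = x∉p⇒x∈∁p (¬end ∘ Equivalence.to isEnd⇔EndVertex ∘ ∈-tabulate⁻)

  ∈NonEnds⁻ : v ∈ NonEnds → ¬ EndVertex G v
  ∈NonEnds⁻ v∈ end = x∈∁p⇒x∉p v∈ (∈-tabulate⁺ (Equivalence.from isEnd⇔EndVertex end))

  ∈NonEnds-v⁺ : ¬ EndVertex G x → x ≢ v → x ∈ NonEnds - v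
  ∈NonEnds-v⁺ ¬end x≢v = x∈p∧x≢y⇒x∈p-y (∈NonEnds⁺ ¬end) x≢v

  ∈NonEnds-v⁻ : x ∈ NonEnds - v → ¬ EndVertex G x × x ≢ v
  ∈NonEnds-v⁻ x∈ = ∈NonEnds⁻ (p─q⊆p _ _ x∈) , x∈p-y⇒x≢y x∈

  All-verts : (w : WalkIn G P a b k) → All P (verts G w)
  All-verts [ pa ] = pa ∷ []
  All-verts (step _ pa w) = pa ∷ All-verts w

  All-head : (w : WalkIn G P a b k) → All Q (verts G w) → Q a
  All-head [ _ ] (qa ∷ _) = qa
  All-head (step _ _ _) (qa ∷ _) = qa

  restrict : (w : WalkIn G P a b k) → All Q (verts G w) → WalkIn G Q a b k
  restrict [ _ ] (qa ∷ []) = [ qa ]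
  restrict (step ab _ w) (qa ∷ qs) = step ab qa (restrict w qs)

  verts-restrict : (w : WalkIn G P a b k) (qs : All Q (verts G w)) → verts G (restrict w qs) ≡ verts G w
  verts-restrict [ _ ] (_ ∷ []) = refl
  verts-restrict (step _ _ w) (_ ∷ qs) = cong (_ ∷_) (verts-restrict w qs)

  weaken : (∀ {x} → P x → Q x) → WalkIn G P a b k → WalkIn G Q a b k
  weaken P⇒Q w = restrict w (All.map P⇒Q (All-verts w))

  forget : WalkIn G P a b k → Walk G a b k
  forget = weaken (λ {x} _ → x)

  verts-forget : (w : WalkIn G P a b k) → verts G (forget w) ≡ verts G w
  verts-forget w = verts-restrict w _

  infixr 5 _++_
  _++_ : ∀ {j} → WalkIn G P a b k → WalkIn G P b c j → WalkIn G P a c (k + j)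
  [ _ ] ++ w = w
  step ab pa w ++ w′ = step ab pa (w ++ w′)

  length-verts : (w : WalkIn G P a b k) → length (verts G w) ≡ suc k
  length-verts [ _ ] = refl
  length-verts (step _ _ w) = cong suc (length-verts w)

  first-step : WalkIn G P a b k → a ≡ b ⊎ ∃[ c ] (adj G a c ≡ true × P c)
  first-step [ _ ] = inj₁ refl
  first-step (step ac _ w) = inj₂ (_ , ac , All-head w (All-verts w))

  ≢⇒walk-length>0 : a ≢ b → WalkIn G P a b k → 0 < k
  ≢⇒walk-length>0 a≢a [ _ ] = contradiction refl a≢a
  ≢⇒walk-length>0 _ (step _ _ _) = s≤s z≤n

  closed-under-adj : (S : Fin n → Set) → (∀ {x y} → S x → adj G x y ≡ true → S y) →
                     WalkIn G P a b k → S a → S b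
  closed-under-adj S closed [ _ ] sa = sa
  closed-under-adj S closed (step ab _ w) sa = closed-under-adj S closed w (closed sa ab)

  suffix : (w : WalkIn G P a b k) → Any (x ≡_) (verts G w) → ∃[ j ] (j ≤ k × WalkIn G P x b j)
  suffix [ pa ] (here refl) = 0 , z≤n , [ pa ]
  suffix (step {k = k} ab pa w) (here refl) = suc k , ≤-refl , step ab pa w
  suffix (step _ _ w) (there x∈) with suffix w x∈
  ... | j , j≤k , w′ = j , m≤n⇒m≤1+n j≤k , w′

  Shortest : (Fin n → Set) → Fin n → Fin n → ℕ → Set
  Shortest P a b k = ∀ j → WalkIn G P a b j → k ≤ j

  shortest⇒unique : (w : WalkIn G P a b k) → Shortest P a b k → Unique (verts G w)
  shortest⇒unique [ _ ] _ = [] ∷ []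
  shortest⇒unique (step {k = k} ab pa w) shortest = ¬Any⇒All¬ _ not-revisited ∷ shortest⇒unique w shortest-tail
    where
    not-revisited : ¬ Any (_ ≡_) (verts G w)
    not-revisited a∈ with suffix w a∈
    ... | j , j≤k , w′ = 1+n≰n (≤-trans (shortest j w′) j≤k)
    shortest-tail : Shortest _ _ _ k
    shortest-tail j w′ = ≤-pred (shortest (suc j) (step ab pa w′))

  walk? : U.Decidable P → ∀ k a b → Dec (WalkIn G P a b k)
  walk? P? zero a b with a ≟ b | P? a
  ... | yes refl | yes pa = yes [ pa ]
  ... | yes refl | no ¬pa = no λ { [ pa ] → ¬pa pa }
  ... | no a≢b | _ = no λ { [ _ ] → a≢b refl }
  walk? P? (suc k) a b with any? (λ c → (adj G a c ≟ᵇ true) ×-dec (P? a ×-dec walk? P? k c b))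
  ... | yes (_ , ac , pa , w) = yes (step ac pa w)
  ... | no none = no λ { (step ac pa w) → none (_ , ac , pa , w) }

  shortest : U.Decidable P → WalkIn G P a b k → ∃[ l ] (WalkIn G P a b l × Shortest P a b l)
  shortest {a = a} {b} P? = least (λ l → walk? P? l a b)

  shortest<n : (w : WalkIn G P a b k) → Shortest P a b k → k < n
  shortest<n w shortest-w =
    subst (_≤ n) (length-verts w) (unique⇒length≤n (shortest⇒unique w shortest-w))

  reachable? : U.Decidable P → ∀ a b → Dec (∃[ k ] WalkIn G P a b k)
  reachable? P? a b with anyUpTo? (λ k → walk? P? k a b) n
  ... | yes (k , _ , w) = yes (k , w)
  ... | no none = no λ (_ , w) →
    let l , w′ , shortest-w′ = shortest P? w in none (l , shortest<n w′ shortest-w′ , w′)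

  cut? : U.Decidable (CutVertex G)
  cut? v = any? λ a → any? λ b → ¬? (a ≟ v) ×-dec ¬? (b ≟ v) ×-dec
    map′ (λ unreachable k w → unreachable (k , w)) (λ unreachable (k , w) → unreachable k w)
         (¬? (reachable? (≢? v) a b))

  path-¬End : (w : WalkIn G P a b k) → Unique (verts G w) → ¬ EndVertex G a → ¬ EndVertex G b →
              All (λ x → ¬ EndVertex G x) (verts G w)
  path-¬End [ _ ] _ ¬end-a _ = ¬end-a ∷ []
  path-¬End (step _ _ w@([ _ ])) (_ ∷ w-unique) ¬end-a ¬end-b = ¬end-a ∷ path-¬End w w-unique ¬end-b ¬end-b
  path-¬End (step ab _ w@(step bc _ w′)) ((_ ∷ a∉w′) ∷ w-unique) ¬end-a ¬end-d =
    ¬end-a ∷ path-¬End w w-unique (two-neighbours⇒¬End (adj-sym ab) bc (All-head w′ a∉w′)) ¬end-d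

  connected-dominating : WeaklyConvexDominating G D → ConnectedDominating G D
  connected-dominating (dom , convex) = dom , λ a b a∈ b∈ → let k , w , _ = convex a b a∈ b∈ in k , w

  reach-dominator-avoiding : Dominating G D → v ∉ D → x ≢ v →
    ∃[ x′ ] (x′ ∈ D × (∃[ k ] WalkIn G (_≢ v) x x′ k) × (∃[ k ] WalkIn G (_≢ v) x′ x k))
  reach-dominator-avoiding {D = D} {v = v} {x = x} dom v∉ x≢v with x ∈? D | dom x
  ... | yes x∈ | _ = x , x∈ , (0 , [ x≢v ]) , (0 , [ x≢v ])
  ... | no x∉ | inj₁ x∈ = contradiction x∈ x∉
  ... | no _ | inj₂ (x′ , x′∈ , xx′) =
    x′ , x′∈ , (1 , step xx′ x≢v [ x′≢v ]) , (1 , step (adj-sym xx′) x′≢v [ x≢v ])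
    where
    x′≢v : x′ ≢ v
    x′≢v = x∈p∧y∉p⇒x≢y x′∈ v∉

  cut∈connected-dominating : ConnectedDominating G D → CutVertex G v → v ∈ D
  cut∈connected-dominating {D} {v} (dom , D-connected) (x , y , x≢v , y≢v , separated) with v ∈? D
  ... | yes v∈ = v∈
  ... | no v∉
    with x′ , x′∈ , (_ , x→x′) , _ ← reach-dominator-avoiding dom v∉ x≢v
       | y′ , y′∈ , _ , (_ , y′→y) ← reach-dominator-avoiding dom v∉ y≢v
    with _ , x′→y′ ← D-connected x′ y′ x′∈ y′∈
    = ⊥-elim (separated _ (x→x′ ++ weaken (λ z∈ → x∈p∧y∉p⇒x≢y z∈ v∉) x′→y′ ++ y′→y))

  outside⇒avoided : v ∉ D → (w : WalkIn G (_∈ D) a b k) → All (v ≢_) (verts G (forget w))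
  outside⇒avoided v∉ w = subst (All _) (≡.sym (verts-forget w))
    (All.map (λ x∈ → ≢-sym (x∈p∧y∉p⇒x≢y x∈ v∉)) (All-verts w))

  module _ (girth : GirthAtLeast7 G) where

    no-cycle-through-outsider : WeaklyConvex G D → v ∉ D → w ∈ D → u ∈ D → w ≢ u →
                                adj G v w ≡ true → adj G v u ≡ true → ⊥
    no-cycle-through-outsider {v = v} {w} {u} convex v∉ w∈ u∈ w≢u vw vu
      with k , P , shortest-P ← convex w u w∈ u∈ =
      from-no (7 ≤? 4) (≤-trans cycle≥7 (s≤s (s≤s k≤2)))
      where
      k≤2 : k ≤ 2
      k≤2 = shortest-P 2 (step (adj-sym vw) w (step vu v [ u ]))
      cycle≥7 : 7 ≤ suc (suc k)
      cycle≥7 = girth v u (suc k) (step vw v (forget P)) (s≤s (≢⇒walk-length>0 w≢u P))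
        (outside⇒avoided v∉ P ∷ shortest⇒unique (forget P) shortest-P) (adj-sym vu)

    no-cycle-through-two-outsiders : WeaklyConvex G D → v ∉ D → w ∉ D → z ∈ D → u ∈ D →
                                     adj G v w ≡ true → adj G w z ≡ true → adj G v u ≡ true → ⊥
    no-cycle-through-two-outsiders {v = v} {w} {z} {u} convex v∉ w∉ z∈ u∈ vw wz vu
      with k , P , shortest-P ← convex z u z∈ u∈ =
      from-no (7 ≤? 6) (≤-trans cycle≥7 (s≤s (s≤s (s≤s k≤3))))
      where
      k≤3 : k ≤ 3
      k≤3 = shortest-P 3 (step (adj-sym wz) z (step (adj-sym vw) w (step vu v [ u ])))
      cycle≥7 : 7 ≤ suc (suc (suc k))
      cycle≥7 = girth v u (suc (suc k)) (step vw v (step wz w (forget P))) (s≤s (s≤s z≤n))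
        ((adj⇒≢ vw ∷ outside⇒avoided v∉ P) ∷ outside⇒avoided w∉ P ∷ shortest⇒unique (forget P) shortest-P)
        (adj-sym vu)

    weaklyConvexDominating⇒¬End∈ : WeaklyConvexDominating G D → ¬ EndVertex G v → v ∈ D
    weaklyConvexDominating⇒¬End∈ {D} {v} (dom , convex) ¬end with v ∈? D | dom v
    ... | yes v∈ | _ = v∈
    ... | no v∉ | inj₁ v∈ = contradiction v∈ v∉
    ... | no v∉ | inj₂ (u , u∈ , vu) with ¬End⇒another-neighbour ¬end vu
    ... | w , w≢u , vw with w ∈? D | dom w
    ... | yes w∈ | _ = ⊥-elim (no-cycle-through-outsider convex v∉ w∈ u∈ w≢u vw vu)
    ... | no w∉ | inj₁ w∈ = contradiction w∈ w∉
    ... | no w∉ | inj₂ (z , z∈ , wz) = ⊥-elim (no-cycle-through-two-outsiders convex v∉ w∉ z∈ u∈ vw wz vu)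

  module _ (n≥3 : 3 ≤ n) (connected : Connected G) where

    has-neighbour : ∀ v → ∃[ u ] adj G v u ≡ true
    has-neighbour v with w , w≢v , _ ← another-vertex n≥3 v v | first-step (proj₂ (connected v w))
    ... | inj₁ v≡w = contradiction (≡.sym v≡w) w≢v
    ... | inj₂ (u , vu , _) = u , vu

    -- An end-vertex v and its neighbour u, both of degree 1, would form a component {v, u}.
    End-neighbour-¬End : EndVertex G v → adj G v u ≡ true → ¬ EndVertex G u
    End-neighbour-¬End {v} {u} end-v vu end-u with x , x≢v , x≢u ← another-vertex n≥3 v u =
      [ x≢v , x≢u ]′ (closed-under-adj (λ y → y ≡ v ⊎ y ≡ u) edge-closed (proj₂ (connected v x)) (inj₁ refl))
      where
      edge-closed : ∀ {y z} → y ≡ v ⊎ y ≡ u → adj G y z ≡ true → z ≡ v ⊎ z ≡ u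
      edge-closed (inj₁ refl) yz = inj₂ (End⇒neighbour-unique end-v yz vu)
      edge-closed (inj₂ refl) yz = inj₁ (End⇒neighbour-unique end-u yz (adj-sym vu))

    ¬Cut-neighbour-¬End : ¬ CutVertex G v → adj G v u ≡ true → ¬ EndVertex G u
    ¬Cut-neighbour-¬End {v} {u} ¬cut vu end-u with x , x≢v , x≢u ← another-vertex n≥3 v u =
      ¬cut (u , x , ≢-sym (adj⇒≢ vu) , x≢v , λ _ w → stuck w)
      where
      stuck : WalkIn G (_≢ v) u x k → ⊥
      stuck w with first-step w
      ... | inj₁ u≡x = x≢u (≡.sym u≡x)
      ... | inj₂ (c , uc , c≢v) = c≢v (End⇒neighbour-unique end-u uc (adj-sym vu))

    NonEnds-dominating : Dominating G NonEnds
    NonEnds-dominating v with degree G v ≟ℕ 1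
    ... | no ¬end = inj₁ (∈NonEnds⁺ ¬end)
    ... | yes end = let u , vu = has-neighbour v in inj₂ (u , ∈NonEnds⁺ (End-neighbour-¬End end vu) , vu)

    NonEnds-weaklyConvex : WeaklyConvex G NonEnds
    NonEnds-weaklyConvex a b a∈ b∈ =
      let k , w , shortest-w = shortest (λ x → yes x) (proj₂ (connected a b))
          ¬End-on-w = path-¬End w (shortest⇒unique w shortest-w) (∈NonEnds⁻ a∈) (∈NonEnds⁻ b∈)
      in k , restrict w (All.map ∈NonEnds⁺ ¬End-on-w) , shortest-w

    NonEnds-connectedDominating : ConnectedDominating G NonEnds
    NonEnds-connectedDominating = connected-dominating (NonEnds-dominating , NonEnds-weaklyConvex)

    NonEnds-γwcon : GirthAtLeast7 G → γwcon≡ G (n ∸ nL G)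
    NonEnds-γwcon girth = (NonEnds , (NonEnds-dominating , NonEnds-weaklyConvex) , ∣NonEnds∣) , λ D wcd →
      subst (_≤ ∣ D ∣) ∣NonEnds∣ (p⊆q⇒∣p∣≤∣q∣ λ x∈ → weaklyConvexDominating⇒¬End∈ girth wcd (∈NonEnds⁻ x∈))

    NonEnds-v-dominating : ¬ CutVertex G v → Dominating G (NonEnds - v)
    NonEnds-v-dominating {v} ¬cut x with x ≟ v | degree G x ≟ℕ 1 | has-neighbour x
    ... | yes refl | _ | u , vu = inj₂ (u , ∈NonEnds-v⁺ (¬Cut-neighbour-¬End ¬cut vu) (≢-sym (adj⇒≢ vu)) , vu)
    ... | no x≢v | no ¬end | _ = inj₁ (∈NonEnds-v⁺ ¬end x≢v)
    ... | no _ | yes end | u , xu =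
      inj₂ (u , ∈NonEnds-v⁺ (End-neighbour-¬End end xu) (λ { refl → ¬Cut-neighbour-¬End ¬cut (adj-sym xu) end }) , xu)

    NonEnds-v-connected : ¬ CutVertex G v → ∀ a b → a ∈ NonEnds - v → b ∈ NonEnds - v →
                          ∃[ k ] WalkIn G (_∈ NonEnds - v) a b k
    NonEnds-v-connected {v} ¬cut a b a∈ b∈
      with ¬end-a , a≢v ← ∈NonEnds-v⁻ a∈ | ¬end-b , b≢v ← ∈NonEnds-v⁻ b∈
      with reachable? (≢? v) a b
    ... | no unreachable = contradiction (a , b , a≢v , b≢v , λ k w → unreachable (k , w)) ¬cut
    ... | yes (_ , w) =
      let k , w′ , shortest-w′ = shortest (≢? v) w
          ¬End-on-w′ = path-¬End w′ (shortest⇒unique w′ shortest-w′) ¬end-a ¬end-b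
      in k , restrict w′ (All.zipWith (uncurry ∈NonEnds-v⁺) (¬End-on-w′ , All-verts w′))

    γc≡∣NonEnds∣⇔EndOrCut : ∀ {b} → γc≡ G b → (∣ NonEnds ∣ ≡ b ⇔ (∀ v → EndVertex G v ⊎ CutVertex G v))
    γc≡∣NonEnds∣⇔EndOrCut {b} ((D , D-cd , ∣D∣≡b) , b-min) = mk⇔ every-vertex-EndOrCut NonEnds-minimal
      where
      every-vertex-EndOrCut : ∣ NonEnds ∣ ≡ b → ∀ v → EndVertex G v ⊎ CutVertex G v
      every-vertex-EndOrCut ∣NonEnds∣≡b v with degree G v ≟ℕ 1 | cut? v
      ... | yes end | _ = inj₁ end
      ... | no _ | yes cut = inj₂ cut
      ... | no ¬end | no ¬cut = contradiction (b-min _ (NonEnds-v-dominating ¬cut , NonEnds-v-connected ¬cut))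
        (<⇒≱ (subst (∣ NonEnds - v ∣ <_) ∣NonEnds∣≡b (x∈p⇒∣p-x∣<∣p∣ (∈NonEnds⁺ ¬end))))
      NonEnds-minimal : (∀ v → EndVertex G v ⊎ CutVertex G v) → ∣ NonEnds ∣ ≡ b
      NonEnds-minimal end-or-cut = ≤-antisym (subst (∣ NonEnds ∣ ≤_) ∣D∣≡b (p⊆q⇒∣p∣≤∣q∣ NonEnds⊆D))
        (b-min NonEnds NonEnds-connectedDominating)
        where
        NonEnds⊆D : NonEnds ⊆ D
        NonEnds⊆D {x} x∈ with end-or-cut x
        ... | inj₁ end = contradiction end (∈NonEnds⁻ x∈)
        ... | inj₂ cut = cut∈connected-dominating D-cd cut

theorem2p10 : (n : ℕ) → 3 ≤ n → (G : Graph n) → Connected G → GirthAtLeast7 G →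
    γwcon≡ G (n ∸ nL G) ×
    (∀ a b → γwcon≡ G a → γc≡ G b →
      (a ≡ b ⇔ (∀ (v : Fin n) → EndVertex G v ⊎ CutVertex G v)))
theorem2p10 n n≥3 G connected girth = γwcon , λ a b γwcon-a γc-b →
  subst (λ a → a ≡ b ⇔ _) (trans (∣NonEnds∣ G) (MinSize-unique {G = G} γwcon γwcon-a))
    (γc≡∣NonEnds∣⇔EndOrCut G n≥3 connected γc-b)
  where
  γwcon : γwcon≡ G (n ∸ nL G)
  γwcon = NonEnds-γwcon G n≥3 connected girth
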